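{- Let $G=(V,E)$ be a planar graph with a fixed planar embedding, let $A$ be a node assignment, let $f$ be a face, and let $S$ be a maximum indicator set for $f$. Then $A$ satisfies the matching condition for $f$ if and only if the requirement (demand) of $S$ is satisfied.
   Context: Let $F$ be the set of faces of the fixed embedding. For $i\in\{0,1,2\}$ let $V^i$ be the set of vertices of degree $i$ in $G$, and $\bar V=V^0\cup V^1\cup V^2$; $v\in\bar V$ has $3-\deg_G(v)$ free valencies. A node assignment is a map $A:\bar V\to F$ with each $v$ incident to $A(v)$; $V_f=A^{ -1}(f)$. The indicator sets for $f$ are the following sets $S\subseteq V_f$ (degrees in $G$), each with a demand (a number) and a requirement on the free valencies of vertices in $V_f\setminus S$: (1) joker, demand 1: $S=\{v\}$, $v\in V^2$ with no neighbour in $V_f$; at least one free valency in $V_f\setminus S$. (2) pair, demand 2: $S=\{u,v\}\subseteq V^2$ adjacent; at least two free valencies in $V_f\setminus S$. (3) leaf, demand 2: $S=\{v\}$, $v\in V^1$ whose neighbour has degree 3; at least two distinct vertices of $V_f\setminus S$ with free valencies. (4) branch, demand 3: $S=\{u,r\}$, $u\in V^1$, $r\in V^2$ adjacent; one can choose three free valencies of vertices of $V_f\setminus S$ (a vertex $w$ contributing at most $3-\deg_G(w)$) belonging to at least two distinct vertices, at most one of them on a vertex adjacent to $r$. (5) island, demand 3: $S=\{v\}$, $v\in V^0$; at least three distinct vertices of $V_f\setminus S$ with free valencies. (6) stick, demand 4: $S=\{u,v\}\subseteq V^1$ adjacent; $\sum_{w\in V_f\setminus S}\min\{2,3-\deg_G(w)\}\ge4$.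 (7) demand 4: $S=\{u,v\}\subseteq V^0$; same requirement as (6). (8) 3-cycle, demand 3: three vertices of $V^2$ forming a cycle of $G$; at least three free valencies in $V_f\setminus S$. The demand of $S$ is satisfied if its requirement holds. A maximum indicator set for $f$ is an indicator set for $f$ of largest demand. The matching condition for $f$ holds if the demands of all indicator sets for $f$ are satisfied. -}

module Defs where

open import Data.Nat using (ℕ; zero; suc; _+_; _∸_; _≤_; _<ᵇ_; _⊓_)
open import Data.Bool using (Bool; true; false; _∧_; not)
open import Data.Fin using (Fin; _≟_)
open import Data.List using (List; filter; length; map; allFin)
open import Data.Nat.ListAction using (sum)
open import Data.Product using (_×_; Σ)
open import Relation.Nullary using (¬_; does)
open import Relation.Binary.PropositionalEquality using (_≡_; _≢_)
open import Function.Bundles using (_⇔_)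

record Graph (n : ℕ) : Set where
  field
    adj    : Fin n → Fin n → Bool
    sym    : ∀ u v → adj u v ≡ adj v u
    irrefl : ∀ v → adj v v ≡ false

open Graph public

Adj : ∀ {n} → Graph n → Fin n → Fin n → Set
Adj G u v = adj G u v ≡ true

deg : ∀ {n} → Graph n → Fin n → ℕ
deg {n} G v = length (filter (λ w → adj G v w ≡? true) (allFin n))
  where
  _≡?_ : (a b : Bool) → Relation.Nullary.Dec (a ≡ b)
  _≡?_ = Data.Bool._≟_
  open import Data.Bool using (_≟_)

fv : ∀ {n} → Graph n → Fin n → ℕ
fv G v = 3 ∸ deg G v

-- A planar graph with a fixed embedding is represented abstractly by a
-- finite face set Fin m together with a vertex–face incidence relation
--.

IsNodeAssignment : ∀ {n m} (G : Graph n) (Inc : Fin n → Fin m → Set)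
                   (A : Fin n → Fin m) → Set
IsNodeAssignment G Inc A = ∀ v → deg G v ≤ 2 → Inc v (A v)

inVfᵇ : ∀ {n m} → Graph n → (Fin n → Fin m) → Fin m → Fin n → Bool
inVfᵇ G A f v = (deg G v <ᵇ 3) ∧ does (A v ≟ f)

InVf : ∀ {n m} → Graph n → (Fin n → Fin m) → Fin m → Fin n → Set
InVf G A f v = inVfᵇ G A f v ≡ true

data Cand (n : ℕ) : Set where
  joker    : Fin n → Cand n
  pair     : Fin n → Fin n → Cand n
  leaf     : Fin n → Cand n
  branch   : Fin n → Fin n → Cand n
  island   : Fin n → Cand n
  stick    : Fin n → Fin n → Cand n
  islands2 : Fin n → Fin n → Cand n
  cycle3   : Fin n → Fin n → Fin n → Cand n

demand : ∀ {n} → Cand n → ℕ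
demand (joker _)      = 1
demand (pair _ _)     = 2
demand (leaf _)       = 2
demand (branch _ _)   = 3
demand (island _)     = 3
demand (stick _ _)    = 4
demand (islands2 _ _) = 4
demand (cycle3 _ _ _) = 3

inSᵇ : ∀ {n} → Cand n → Fin n → Bool
inSᵇ (joker v)      w = does (w ≟ v)
inSᵇ (pair u v)     w = does (w ≟ u) Data.Bool.∨ does (w ≟ v)
inSᵇ (leaf v)       w = does (w ≟ v)
inSᵇ (branch u r)   w = does (w ≟ u) Data.Bool.∨ does (w ≟ r)
inSᵇ (island v)     w = does (w ≟ v)
inSᵇ (stick u v)    w = does (w ≟ u) Data.Bool.∨ does (w ≟ v)
inSᵇ (islands2 u v) w = does (w ≟ u) Data.Bool.∨ does (w ≟ v)
inSᵇ (cycle3 a b c) w = does (w ≟ a) Data.Bool.∨ does (w ≟ b) Data.Bool.∨ does (w ≟ c)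

IsIndicator : ∀ {n m} → Graph n → (Fin n → Fin m) → Fin m → Cand n → Set
IsIndicator G A f (joker v) =
  InVf G A f v × deg G v ≡ 2 × (∀ w → Adj G v w → ¬ InVf G A f w)
IsIndicator G A f (pair u v) =
  InVf G A f u × InVf G A f v × deg G u ≡ 2 × deg G v ≡ 2 × Adj G u v
IsIndicator G A f (leaf v) =
  InVf G A f v × deg G v ≡ 1 × (∀ w → Adj G v w → deg G w ≡ 3)
IsIndicator G A f (branch u r) =
  InVf G A f u × InVf G A f r × deg G u ≡ 1 × deg G r ≡ 2 × Adj G u r
IsIndicator G A f (island v) =
  InVf G A f v × deg G v ≡ 0
IsIndicator G A f (stick u v) =
  InVf G A f u × InVf G A f v × deg G u ≡ 1 × deg G v ≡ 1 × Adj G u v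
IsIndicator G A f (islands2 u v) =
  InVf G A f u × InVf G A f v × deg G u ≡ 0 × deg G v ≡ 0 × u ≢ v
IsIndicator G A f (cycle3 a b c) =
  InVf G A f a × InVf G A f b × InVf G A f c ×
  deg G a ≡ 2 × deg G b ≡ 2 × deg G c ≡ 2 ×
  Adj G a b × Adj G b c × Adj G a c

rest : ∀ {n m} → Graph n → (Fin n → Fin m) → Fin m → Cand n → List (Fin n)
rest {n} G A f S =
  filter (λ w → inVfᵇ G A f w ∧ not (inSᵇ S w) Data.Bool.≟ true) (allFin n)

freeVal : ∀ {n m} → Graph n → (Fin n → Fin m) → Fin m → Cand n → ℕ
freeVal G A f S = sum (map (fv G) (rest G A f S))

freeVert : ∀ {n m} → Graph n → (Fin n → Fin m) → Fin m → Cand n → ℕ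
freeVert G A f S =
  length (filter (λ w → (0 <ᵇ fv G w) Data.Bool.≟ true) (rest G A f S))

freeVal2 : ∀ {n m} → Graph n → (Fin n → Fin m) → Fin m → Cand n → ℕ
freeVal2 G A f S = sum (map (λ w → 2 ⊓ fv G w) (rest G A f S))

Σv : ∀ {n} → (Fin n → ℕ) → ℕ
Σv {n} c = sum (map c (allFin n))

-- A choice of free valencies for the branch requirement: c w valencies
-- are chosen at w; only vertices of V_f ∖ S, at most 3 - deg w each,
-- three in total, on at least two distinct vertices, and at most one of
-- the chosen valencies lies on a vertex adjacent to r.
BranchChoice : ∀ {n m} → Graph n → (Fin n → Fin m) → Fin m →
               Fin n → Fin n → Set
BranchChoice {n} G A f u r =
  Σ (Fin n → ℕ) λ c →
    (∀ w → inVfᵇ G A f w ∧ not (inSᵇ (branch u r) w) ≡ false → c w ≡ 0) ×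
    (∀ w → c w ≤ fv G w) ×
    Σv c ≡ 3 ×
    2 ≤ length (filter (λ w → (0 <ᵇ c w) Data.Bool.≟ true) (allFin n)) ×
    sum (map c (filter (λ w → adj G r w Data.Bool.≟ true) (allFin n))) ≤ 1

Satisfied : ∀ {n m} → Graph n → (Fin n → Fin m) → Fin m → Cand n → Set
Satisfied G A f S@(joker _)      = 1 ≤ freeVal G A f S
Satisfied G A f S@(pair _ _)     = 2 ≤ freeVal G A f S
Satisfied G A f S@(leaf _)       = 2 ≤ freeVert G A f S
Satisfied G A f (branch u r)     = BranchChoice G A f u r
Satisfied G A f S@(island _)     = 3 ≤ freeVert G A f S
Satisfied G A f S@(stick _ _)    = 4 ≤ freeVal2 G A f S
Satisfied G A f S@(islands2 _ _) = 4 ≤ freeVal2 G A f S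
Satisfied G A f S@(cycle3 _ _ _) = 3 ≤ freeVal G A f S

IsMaxIndicator : ∀ {n m} → Graph n → (Fin n → Fin m) → Fin m → Cand n → Set
IsMaxIndicator G A f S =
  IsIndicator G A f S × (∀ S′ → IsIndicator G A f S′ → demand S′ ≤ demand S)

MatchingCondition : ∀ {n m} → Graph n → (Fin n → Fin m) → Fin m → Set
MatchingCondition G A f = ∀ S → IsIndicator G A f S → Satisfied G A f S

module Submission where

-- The requirement of every kind of indicator set except the branch is a lower bound on a sum over
-- V_f ∖ S.  As S ⊆ V_f, it is a lower bound on the same sum over all of V_f shifted by the fixed
-- contribution of S: at least 2, 4 or 6 free valencies for a joker, pair or 3-cycle, at least 3 or
-- 4 vertices for a leaf or island, and Σ min{2, free valencies} ≥ 8 for the sets of demand 4.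
-- These totals do not depend on S, and the bound forced by a satisfied set implies the bound of
-- every set of smaller or equal demand, except where a leaf meets a pair or a 3-cycle, or an island
-- meets a 3-cycle; there counting the vertices of the sets involved suffices.  A satisfied branch
-- forces 6 free valencies on 4 vertices.  Conversely a branch u r is satisfied by two valencies on
-- a vertex of degree ≤ 1 not adjacent to r plus one more, by one valency on each vertex of a
-- 3-cycle, or, given a satisfied branch u₀ r, by the choice for u₀ r with u and u₀ exchanged.

open import Defs hiding (sym)
import Algebra.Properties.CommutativeMonoid.Sum as CommutativeMonoidSum
open import Data.Bool using (Bool; true; false; _∧_; _∨_; not; if_then_else_)
import Data.Bool as Bool
open import Data.Bool.Properties using (∧-identityʳ; ∧-zeroʳ; T-≡; ¬-not)
open import Data.Empty using (⊥)
open import Data.Fin using (Fin; _≟_) renaming (zero to fzero; suc to fsuc)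
import Data.Fin.Permutation as Perm
open import Data.Fin.Permutation.Components using (transpose)
open import Data.List using (List; []; _∷_; filter; length; map; tabulate; allFin)
open import Data.List.Properties using (map-tabulate)
open import Data.List.Relation.Unary.All as All using (All; []; _∷_)
open import Data.List.Relation.Unary.AllPairs using ([]; _∷_)
open import Data.List.Relation.Unary.Unique.Propositional using (Unique)
open import Data.Nat using (ℕ; zero; suc; _+_; _∸_; _⊓_; _≤_; _<_; _<ᵇ_; _≤?_; z≤n; s≤s)
open import Data.Nat.ListAction using (sum)
open import Data.Nat.Properties
  using ( +-0-commutativeMonoid; +-assoc; +-comm; +-identityʳ; +-cancelʳ-≡; +-cancelʳ-≤
        ; +-mono-≤; +-monoˡ-≤; +-mono-<; m≤m+n; m≤n+m; ≤-refl; ≤-reflexive; ≤-trans; <⇒≱; ≰⇒>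
        ; <ᵇ⇒<; <⇒<ᵇ; m<n⇒0<n∸m; ⊓-glb; m⊓n≤m; m⊓n≤n )
open import Data.Product using (∃; _×_; _,_; proj₁; proj₂)
open import Function using (id; _∘_)
open import Function.Bundles using (_⇔_; mk⇔; Equivalence)
open import Relation.Nullary using (¬_; does; yes; no; contradiction)
open import Relation.Nullary.Decidable using (dec-true; dec-false)
open import Relation.Binary.PropositionalEquality

module ∑ℕ = CommutativeMonoidSum +-0-commutativeMonoid

∧-not-∨ : ∀ a b c → a ∧ not (b ∨ c) ≡ (a ∧ not b) ∧ not c
∧-not-∨ true  true  c = refl
∧-not-∨ true  false c = refl
∧-not-∨ false b     c = refl

<ᵇ-true⇒< : ∀ {m n} → (m <ᵇ n) ≡ true → m < n
<ᵇ-true⇒< {m} {n} e = <ᵇ⇒< m n (Equivalence.from T-≡ e)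

<⇒<ᵇ-true : ∀ {m n} → m < n → (m <ᵇ n) ≡ true
<⇒<ᵇ-true m<n = Equivalence.to T-≡ (<⇒<ᵇ m<n)

m+m≤n+n⇒m≤n : ∀ {m n} → m + m ≤ n + n → m ≤ n
m+m≤n+n⇒m≤n {m} {n} h with m ≤? n
... | yes m≤n = m≤n
... | no m≰n  = contradiction h (<⇒≱ (+-mono-< (≰⇒> m≰n) (≰⇒> m≰n)))

unique₂ : ∀ {A : Set} {x y : A} → x ≢ y → Unique (x ∷ y ∷ [])
unique₂ x≢y = (x≢y ∷ []) ∷ [] ∷ []

unique₃ : ∀ {A : Set} {x y z : A} → x ≢ y → x ≢ z → y ≢ z → Unique (x ∷ y ∷ z ∷ [])
unique₃ x≢y x≢z y≢z = (x≢y ∷ x≢z ∷ []) ∷ unique₂ y≢z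

sum-map-const-1 : ∀ {A : Set} (xs : List A) → sum (map (λ _ → 1) xs) ≡ length xs
sum-map-const-1 []       = refl
sum-map-const-1 (x ∷ xs) = cong suc (sum-map-const-1 xs)

restrict : ∀ {n} → (Fin n → Bool) → (Fin n → ℕ) → Fin n → ℕ
restrict p g w = if p w then g w else 0

point : ∀ {n} → Fin n → ℕ → Fin n → ℕ
point x k w = if does (w ≟ x) then k else 0

point-self : ∀ {n} (x : Fin n) k → point x k x ≡ k
point-self x k rewrite dec-true (x ≟ x) refl = refl

Σv≡sum : ∀ {n} (f : Fin n → ℕ) → Σv f ≡ ∑ℕ.sum f
Σv≡sum f = trans (cong sum (map-tabulate id f)) (sum-tabulate f)
  where
  sum-tabulate : ∀ {n} (f : Fin n → ℕ) → sum (tabulate f) ≡ ∑ℕ.sum f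
  sum-tabulate {zero}  f = refl
  sum-tabulate {suc n} f = cong (f fzero +_) (sum-tabulate (f ∘ fsuc))

Σv-cong : ∀ {n} {f g : Fin n → ℕ} → (∀ w → f w ≡ g w) → Σv f ≡ Σv g
Σv-cong {f = f} {g} f≗g = trans (Σv≡sum f) (trans (∑ℕ.sum-cong-≗ f≗g) (sym (Σv≡sum g)))

Σv-+ : ∀ {n} (f g : Fin n → ℕ) → Σv (λ w → f w + g w) ≡ Σv f + Σv g
Σv-+ f g = trans (Σv≡sum (λ w → f w + g w))
                 (trans (∑ℕ.∑-distrib-+ f g) (sym (cong₂ _+_ (Σv≡sum f) (Σv≡sum g))))

Σv-mono : ∀ {n} {f g : Fin n → ℕ} → (∀ w → f w ≤ g w) → Σv f ≤ Σv g
Σv-mono {f = f} {g} f≤g = subst₂ _≤_ (sym (Σv≡sum f)) (sym (Σv≡sum g)) (sum-mono f≤g)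
  where
  sum-mono : ∀ {n} {f g : Fin n → ℕ} → (∀ w → f w ≤ g w) → ∑ℕ.sum f ≤ ∑ℕ.sum g
  sum-mono {zero}  _   = z≤n
  sum-mono {suc n} f≤g = +-mono-≤ (f≤g fzero) (sum-mono (f≤g ∘ fsuc))

Σv-point : ∀ {n} (x : Fin n) k → Σv (point x k) ≡ k
Σv-point x k = trans (Σv≡sum (point x k)) (sum-point x)
  where
  sum-point : ∀ {n} (x : Fin n) → ∑ℕ.sum (point x k) ≡ k
  sum-point {suc n} fzero    = trans (cong (k +_) (∑ℕ.sum-replicate-zero n)) (+-identityʳ k)
  sum-point {suc n} (fsuc x) = sum-point x

Σv-transpose : ∀ {n} (f : Fin n → ℕ) i j → Σv (f ∘ transpose i j) ≡ Σv f
Σv-transpose f i j = trans (Σv≡sum (f ∘ transpose i j))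
  (trans (sym (∑ℕ.sum-permute f (Perm.transpose i j))) (sym (Σv≡sum f)))

Σv-restrict-positive : ∀ {n} (p : Fin n → Bool) g → 1 ≤ Σv (restrict p g) → ∃ λ w → p w ≡ true
Σv-restrict-positive p g h = witness p g (subst (1 ≤_) (Σv≡sum (restrict p g)) h)
  where
  witness : ∀ {n} (p : Fin n → Bool) g → 1 ≤ ∑ℕ.sum (restrict p g) → ∃ λ w → p w ≡ true
  witness {suc n} p g h with p fzero in eq
  ... | true  = fzero , eq
  ... | false with witness (p ∘ fsuc) (g ∘ fsuc) h
  ...   | w , pw = fsuc w , pw

transpose-right : ∀ {n} (i j : Fin n) → transpose i j j ≡ i
transpose-right i j with j ≟ i
... | yes j≡i = j≡i
... | no j≢i rewrite dec-true (j ≟ j) refl = refl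

transpose-left : ∀ {n} (i j : Fin n) → transpose i j i ≡ j
transpose-left i j rewrite dec-true (i ≟ i) refl = refl

transpose-other : ∀ {n} {i j k : Fin n} → k ≢ i → k ≢ j → transpose i j k ≡ k
transpose-other {i = i} {j} {k} k≢i k≢j rewrite dec-false (k ≟ i) k≢i | dec-false (k ≟ j) k≢j = refl

transpose-invariant : ∀ {n} {B : Set} (h : Fin n → B) {i j} → h i ≡ h j →
                      ∀ k → h (transpose i j k) ≡ h k
transpose-invariant h {i} {j} hi≡hj k with k ≟ i
... | yes refl = sym hi≡hj
... | no k≢i with k ≟ j
...   | yes refl = hi≡hj
...   | no _ = refl

infixl 6 _∖₁_ _∖_

_∖₁_ : ∀ {n} → (Fin n → Bool) → Fin n → Fin n → Bool
(p ∖₁ x) w = p w ∧ not (does (w ≟ x))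

_∖_ : ∀ {n} → (Fin n → Bool) → List (Fin n) → Fin n → Bool
p ∖ []       = p
p ∖ (x ∷ xs) = (p ∖₁ x) ∖ xs

∖₁-intro : ∀ {n} {p : Fin n → Bool} {w x} → p w ≡ true → w ≢ x → (p ∖₁ x) w ≡ true
∖₁-intro {w = w} {x} pw w≢x rewrite pw | dec-false (w ≟ x) w≢x = refl

∖-intro : ∀ {n} {p : Fin n → Bool} {w} xs → p w ≡ true → All (w ≢_) xs → (p ∖ xs) w ≡ true
∖-intro []       pw []           = pw
∖-intro {p = p} (x ∷ xs) pw (w≢x ∷ w∉xs) =
  ∖-intro {p = p ∖₁ x} xs (∖₁-intro {p = p} pw w≢x) w∉xs

Σv-restrict-∖₁ : ∀ {n} (p : Fin n → Bool) g x → p x ≡ true →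
                 Σv (restrict p g) ≡ Σv (restrict (p ∖₁ x) g) + g x
Σv-restrict-∖₁ p g x px = begin
  Σv (restrict p g)                                    ≡⟨ Σv-cong split ⟩
  Σv (λ w → restrict (p ∖₁ x) g w + point x (g x) w)  ≡⟨ Σv-+ (restrict (p ∖₁ x) g) (point x (g x)) ⟩
  Σv (restrict (p ∖₁ x) g) + Σv (point x (g x))       ≡⟨ cong (Σv (restrict (p ∖₁ x) g) +_)
                                                               (Σv-point x (g x)) ⟩
  Σv (restrict (p ∖₁ x) g) + g x                       ∎
  where
  open ≡-Reasoning
  split : ∀ w → restrict p g w ≡ restrict (p ∖₁ x) g w + point x (g x) w
  split w with w ≟ x
  ... | yes refl rewrite px = refl
  ... | no _ rewrite ∧-identityʳ (p w) = sym (+-identityʳ _)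

∖₁-elim : ∀ {n} {p : Fin n → Bool} {w x} → (p ∖₁ x) w ≡ true → p w ≡ true × w ≢ x
∖₁-elim {p = p} {w} {x} h with p w | w ≟ x
∖₁-elim () | true  | yes _
... | true  | no w≢x = refl , w≢x

∖-elim : ∀ {n} {p : Fin n → Bool} {w} xs → (p ∖ xs) w ≡ true → p w ≡ true × All (w ≢_) xs
∖-elim []       h = h , []
∖-elim {p = p} (x ∷ xs) h with ∖-elim {p = p ∖₁ x} xs h
... | h′ , w∉xs with ∖₁-elim {p = p} h′
...   | pw , w≢x = pw , w≢x ∷ w∉xs

Σv-restrict-∖ : ∀ {n} (p : Fin n → Bool) g xs → Unique xs → All (λ x → p x ≡ true) xs →
                Σv (restrict p g) ≡ Σv (restrict (p ∖ xs) g) + sum (map g xs)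
Σv-restrict-∖ p g []       _            _          = sym (+-identityʳ _)
Σv-restrict-∖ p g (x ∷ xs) (x∉xs ∷ !xs) (px ∷ pxs) = begin
  Σv (restrict p g)                      ≡⟨ Σv-restrict-∖₁ p g x px ⟩
  Σv (restrict (p ∖₁ x) g) + g x         ≡⟨ cong (_+ g x) (Σv-restrict-∖ (p ∖₁ x) g xs !xs pxs′) ⟩
  Σv remaining + sum (map g xs) + g x    ≡⟨ +-assoc (Σv remaining) (sum (map g xs)) (g x) ⟩
  Σv remaining + (sum (map g xs) + g x)  ≡⟨ cong (Σv remaining +_) (+-comm (sum (map g xs)) (g x)) ⟩
  Σv remaining + (g x + sum (map g xs))  ∎
  where
  open ≡-Reasoning
  remaining : Fin _ → ℕ
  remaining = restrict (p ∖₁ x ∖ xs) g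
  pxs′ : All (λ y → (p ∖₁ x) y ≡ true) xs
  pxs′ = All.zipWith (λ (py , x≢y) → ∖₁-intro {p = p} py (x≢y ∘ sym)) (pxs , x∉xs)

Σv-restrict-≥ : ∀ {n} (p : Fin n → Bool) g xs → Unique xs → All (λ x → p x ≡ true) xs →
                sum (map g xs) ≤ Σv (restrict p g)
Σv-restrict-≥ p g xs !xs pxs =
  subst (sum (map g xs) ≤_) (sym (Σv-restrict-∖ p g xs !xs pxs)) (m≤n+m _ _)

sum-filter : ∀ {n} (p : Fin n → Bool) g xs →
             sum (map g (filter (λ w → p w Bool.≟ true) xs)) ≡ sum (map (restrict p g) xs)
sum-filter p g []       = refl
sum-filter p g (x ∷ xs) with p x
... | true  = cong (g x +_) (sum-filter p g xs)
... | false = sum-filter p g xs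

length-filter : ∀ {n} (p : Fin n → Bool) xs →
                length (filter (λ w → p w Bool.≟ true) xs) ≡ sum (map (restrict p (λ _ → 1)) xs)
length-filter p []       = refl
length-filter p (x ∷ xs) with p x
... | true  = cong suc (length-filter p xs)
... | false = length-filter p xs

module _ {n} (G : Graph n) where

  Adj-sym : ∀ {u v} → Adj G u v → Adj G v u
  Adj-sym {u} {v} uv = trans (sym (Graph.sym G u v)) uv

  Adj⇒≢ : ∀ {u v} → Adj G u v → u ≢ v
  Adj⇒≢ {u} uu refl with trans (sym uu) (irrefl G u)
  ... | ()

  ≢-by-deg : ∀ {x y a b} → deg G x ≡ a → deg G y ≡ b → a ≢ b → x ≢ y
  ≢-by-deg dx dy a≢b refl = a≢b (trans (sym dx) dy)

  fv-deg : ∀ {v d} → deg G v ≡ d → fv G v ≡ 3 ∸ d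
  fv-deg = cong (3 ∸_)

  deg≡Σv : ∀ v → deg G v ≡ Σv (restrict (adj G v) (λ _ → 1))
  deg≡Σv v = length-filter (adj G v) (allFin n)

  length≤deg : ∀ {v} xs → Unique xs → All (Adj G v) xs → length xs ≤ deg G v
  length≤deg {v} xs !xs vxs = subst₂ _≤_ (sum-map-const-1 xs) (sym (deg≡Σv v))
    (Σv-restrict-≥ (adj G v) (λ _ → 1) xs !xs vxs)

  deg0-isolated : ∀ {v x} → deg G v ≡ 0 → ¬ Adj G v x
  deg0-isolated {x = x} d vx with subst (1 ≤_) d (length≤deg (x ∷ []) ([] ∷ []) (vx ∷ []))
  ... | ()

  deg1-neighbour-unique : ∀ {v x y} → deg G v ≡ 1 → Adj G v x → Adj G v y → x ≡ y
  deg1-neighbour-unique {x = x} {y} d vx vy with x ≟ y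
  ... | yes x≡y = x≡y
  ... | no x≢y with subst (2 ≤_) d (length≤deg (x ∷ y ∷ []) (unique₂ x≢y) (vx ∷ vy ∷ []))
  ...   | s≤s ()

  deg2-three-neighbours : ∀ {v x y z} → deg G v ≡ 2 → Unique (x ∷ y ∷ z ∷ []) →
                          All (Adj G v) (x ∷ y ∷ z ∷ []) → ⊥
  deg2-three-neighbours d !xyz vxyz with subst (3 ≤_) d (length≤deg (_ ∷ _ ∷ _ ∷ []) !xyz vxyz)
  ... | s≤s (s≤s ())

  2≤fv : ∀ {v d} → deg G v ≡ d → 2 ≤ 3 ∸ d → 2 ≤ fv G v
  2≤fv dv = subst (2 ≤_) (sym (fv-deg dv))

members : ∀ {n} → Cand n → List (Fin n)
members (joker v)      = v ∷ []
members (pair u v)     = u ∷ v ∷ []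
members (leaf v)       = v ∷ []
members (branch u r)   = u ∷ r ∷ []
members (island v)     = v ∷ []
members (stick u v)    = u ∷ v ∷ []
members (islands2 u v) = u ∷ v ∷ []
members (cycle3 a b c) = a ∷ b ∷ c ∷ []

module Face {n m} (G : Graph n) (A : Fin n → Fin m) (f : Fin m) where

  inVf : Fin n → Bool
  inVf = inVfᵇ G A f

  restᵇ : Cand n → Fin n → Bool
  restᵇ S w = inVf w ∧ not (inSᵇ S w)

  one : Fin n → ℕ
  one _ = 1

  cap2 : Fin n → ℕ
  cap2 w = 2 ⊓ fv G w

  valencyTotal vertexTotal cappedTotal : ℕ
  valencyTotal = Σv (restrict inVf (fv G))
  vertexTotal  = Σv (restrict inVf one)
  cappedTotal  = Σv (restrict inVf cap2)

  Ind Sat : Cand n → Set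
  Ind = IsIndicator G A f
  Sat = Satisfied G A f

  open Equivalence using (to; from)

  inVf⇒1≤fv : ∀ {w} → inVf w ≡ true → 1 ≤ fv G w
  inVf⇒1≤fv {w} e with deg G w <ᵇ 3 in lt
  ... | true = m<n⇒0<n∸m {deg G w} {3} (<ᵇ-true⇒< lt)

  restᵇ⇒inVf : ∀ S {w} → restᵇ S w ≡ true → inVf w ≡ true
  restᵇ⇒inVf S {w} e with inVf w
  ... | true = refl

  vertex≤capped : vertexTotal ≤ cappedTotal
  vertex≤capped = Σv-mono pointwise
    where
    pointwise : ∀ w → restrict inVf one w ≤ restrict inVf cap2 w
    pointwise w with inVf w in e
    ... | true  = ⊓-glb (s≤s z≤n) (inVf⇒1≤fv e)
    ... | false = z≤n

  capped≤valency : cappedTotal ≤ valencyTotal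
  capped≤valency = Σv-mono pointwise
    where
    pointwise : ∀ w → restrict inVf cap2 w ≤ restrict inVf (fv G) w
    pointwise w with inVf w
    ... | true  = m⊓n≤n 2 (fv G w)
    ... | false = z≤n

  capped≤2*vertex : cappedTotal ≤ vertexTotal + vertexTotal
  capped≤2*vertex =
    subst (cappedTotal ≤_) (Σv-+ (restrict inVf one) (restrict inVf one)) (Σv-mono pointwise)
    where
    pointwise : ∀ w → restrict inVf cap2 w ≤ restrict inVf one w + restrict inVf one w
    pointwise w with inVf w
    ... | true  = m⊓n≤m 2 (fv G w)
    ... | false = z≤n

  vertex≤valency : vertexTotal ≤ valencyTotal
  vertex≤valency = ≤-trans vertex≤capped capped≤valency

  8≤capped⇒4≤vertex : 8 ≤ cappedTotal → 4 ≤ vertexTotal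
  8≤capped⇒4≤vertex h = m+m≤n+n⇒m≤n (≤-trans h capped≤2*vertex)

  rest≡∖members : ∀ S w → restᵇ S w ≡ (inVf ∖ members S) w
  rest≡∖members (joker v)      w = refl
  rest≡∖members (pair u v)     w = ∧-not-∨ (inVf w) _ _
  rest≡∖members (leaf v)       w = refl
  rest≡∖members (branch u r)   w = ∧-not-∨ (inVf w) _ _
  rest≡∖members (island v)     w = refl
  rest≡∖members (stick u v)    w = ∧-not-∨ (inVf w) _ _
  rest≡∖members (islands2 u v) w = ∧-not-∨ (inVf w) _ _
  rest≡∖members (cycle3 a b c) w =
    trans (∧-not-∨ (inVf w) _ _) (∧-not-∨ (inVf w ∧ not (does (w ≟ a))) _ _)

  members-in-face : ∀ S → Ind S → Unique (members S) × All (λ x → inVf x ≡ true) (members S)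
  members-in-face (joker v)      (iv , _)                = [] ∷ [] , iv ∷ []
  members-in-face (pair u v)     (iu , iv , _ , _ , uv)  = unique₂ (Adj⇒≢ G uv) , iu ∷ iv ∷ []
  members-in-face (leaf v)       (iv , _)                = [] ∷ [] , iv ∷ []
  members-in-face (branch u r)   (iu , ir , _ , _ , ur)  = unique₂ (Adj⇒≢ G ur) , iu ∷ ir ∷ []
  members-in-face (island v)     (iv , _)                = [] ∷ [] , iv ∷ []
  members-in-face (stick u v)    (iu , iv , _ , _ , uv)  = unique₂ (Adj⇒≢ G uv) , iu ∷ iv ∷ []
  members-in-face (islands2 u v) (iu , iv , _ , _ , u≢v) = unique₂ u≢v , iu ∷ iv ∷ []
  members-in-face (cycle3 a b c) (ia , ib , ic , _ , _ , _ , ab , bc , ac) =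
    unique₃ (Adj⇒≢ G ab) (Adj⇒≢ G ac) (Adj⇒≢ G bc) , ia ∷ ib ∷ ic ∷ []

  total≡rest+members : ∀ S g → Ind S →
    Σv (restrict inVf g) ≡ Σv (restrict (restᵇ S) g) + sum (map g (members S))
  total≡rest+members S g i with members-in-face S i
  ... | !S , S⊆Vf = trans (Σv-restrict-∖ inVf g (members S) !S S⊆Vf)
                          (cong (_+ sum (map g (members S))) (sym (Σv-cong rest≗∖members)))
    where
    rest≗∖members : ∀ w → restrict (restᵇ S) g w ≡ restrict (inVf ∖ members S) g w
    rest≗∖members w = cong (λ b → if b then g w else 0) (rest≡∖members S w)

  members≤total : ∀ S g → Ind S → sum (map g (members S)) ≤ Σv (restrict inVf g)
  members≤total S g i = subst (_ ≤_) (sym (total≡rest+members S g i)) (m≤n+m _ _)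

  threshold : ∀ S {g X k c} → Ind S → X ≡ Σv (restrict (restᵇ S) g) → sum (map g (members S)) ≡ c →
              k ≤ X ⇔ k + c ≤ Σv (restrict inVf g)
  threshold S {g} {X} {k} {c} i X≡ members≡ = mk⇔
    (λ k≤X → subst (k + c ≤_) (sym total≡) (+-monoˡ-≤ c k≤X))
    (λ k+c≤ → +-cancelʳ-≤ c k X (subst (k + c ≤_) total≡ k+c≤))
    where
    total≡ : Σv (restrict inVf g) ≡ X + c
    total≡ = trans (total≡rest+members S g i) (cong₂ _+_ (sym X≡) members≡)

  freeVal≡ : ∀ S → freeVal G A f S ≡ Σv (restrict (restᵇ S) (fv G))
  freeVal≡ S = sum-filter (restᵇ S) (fv G) (allFin n)

  freeVal2≡ : ∀ S → freeVal2 G A f S ≡ Σv (restrict (restᵇ S) cap2)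
  freeVal2≡ S = sum-filter (restᵇ S) cap2 (allFin n)

  freeVert≡ : ∀ S → freeVert G A f S ≡ Σv (restrict (restᵇ S) one)
  freeVert≡ S = begin
    freeVert G A f S                                  ≡⟨ length-filter positive (rest G A f S) ⟩
    sum (map (restrict positive one) (rest G A f S))  ≡⟨ sum-filter (restᵇ S) (restrict positive one) (allFin n) ⟩
    Σv (restrict (restᵇ S) (restrict positive one))   ≡⟨ Σv-cong every-vertex-positive ⟩
    Σv (restrict (restᵇ S) one)                       ∎
    where
    open ≡-Reasoning
    positive : Fin n → Bool
    positive w = 0 <ᵇ fv G w
    every-vertex-positive : ∀ w → restrict (restᵇ S) (restrict positive one) w ≡ restrict (restᵇ S) one w
    every-vertex-positive w with restᵇ S w in e
    ... | false = refl
    ... | true rewrite <⇒<ᵇ-true (inVf⇒1≤fv (restᵇ⇒inVf S e)) = refl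

  joker⇔ : ∀ {v} → Ind (joker v) → Sat (joker v) ⇔ 2 ≤ valencyTotal
  joker⇔ {v} i@(_ , d , _) = threshold (joker v) i (freeVal≡ (joker v)) (cong (_+ 0) (fv-deg G d))

  pair⇔ : ∀ {u v} → Ind (pair u v) → Sat (pair u v) ⇔ 4 ≤ valencyTotal
  pair⇔ {u} {v} i@(_ , _ , du , dv , _) = threshold (pair u v) i (freeVal≡ (pair u v))
    (cong₂ (λ a b → a + (b + 0)) (fv-deg G du) (fv-deg G dv))

  leaf⇔ : ∀ {v} → Ind (leaf v) → Sat (leaf v) ⇔ 3 ≤ vertexTotal
  leaf⇔ {v} i = threshold (leaf v) i (freeVert≡ (leaf v)) refl

  island⇔ : ∀ {v} → Ind (island v) → Sat (island v) ⇔ 4 ≤ vertexTotal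
  island⇔ {v} i = threshold (island v) i (freeVert≡ (island v)) refl

  stick⇔ : ∀ {u v} → Ind (stick u v) → Sat (stick u v) ⇔ 8 ≤ cappedTotal
  stick⇔ {u} {v} i@(_ , _ , du , dv , _) = threshold (stick u v) i (freeVal2≡ (stick u v))
    (cong₂ (λ a b → 2 ⊓ a + (2 ⊓ b + 0)) (fv-deg G du) (fv-deg G dv))

  islands2⇔ : ∀ {u v} → Ind (islands2 u v) → Sat (islands2 u v) ⇔ 8 ≤ cappedTotal
  islands2⇔ {u} {v} i@(_ , _ , du , dv , _) = threshold (islands2 u v) i (freeVal2≡ (islands2 u v))
    (cong₂ (λ a b → 2 ⊓ a + (2 ⊓ b + 0)) (fv-deg G du) (fv-deg G dv))

  cycle3⇔ : ∀ {a b c} → Ind (cycle3 a b c) → Sat (cycle3 a b c) ⇔ 6 ≤ valencyTotal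
  cycle3⇔ {a} {b} {c} i@(_ , _ , _ , da , db , dc , _) = threshold (cycle3 a b c) i (freeVal≡ (cycle3 a b c))
    (cong₂ _+_ (fv-deg G da) (cong₂ (λ y z → y + (z + 0)) (fv-deg G db) (fv-deg G dc)))

  leaf-pair-bounds : ∀ {x u v} → Ind (leaf x) → Ind (pair u v) → 3 ≤ vertexTotal × 4 ≤ valencyTotal
  leaf-pair-bounds {x} {u} {v} (ix , dx , _) (iu , iv , du , dv , uv) =
    Σv-restrict-≥ inVf one xs !xs xs⊆Vf ,
    subst (_≤ valencyTotal)
      (cong₂ _+_ (fv-deg G dx) (cong₂ (λ a b → a + (b + 0)) (fv-deg G du) (fv-deg G dv)))
      (Σv-restrict-≥ inVf (fv G) xs !xs xs⊆Vf)
    where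
    xs = x ∷ u ∷ v ∷ []
    !xs : Unique xs
    !xs = unique₃ (≢-by-deg G dx du λ ()) (≢-by-deg G dx dv λ ()) (Adj⇒≢ G uv)
    xs⊆Vf : All (λ w → inVf w ≡ true) xs
    xs⊆Vf = ix ∷ iu ∷ iv ∷ []

  island-cycle3-bounds : ∀ {x a b c} → Ind (island x) → Ind (cycle3 a b c) →
                         4 ≤ vertexTotal × 6 ≤ valencyTotal
  island-cycle3-bounds {x} {a} {b} {c} (ix , dx) (ia , ib , ic , da , db , dc , ab , bc , ac) =
    Σv-restrict-≥ inVf one xs !xs xs⊆Vf ,
    subst (_≤ valencyTotal)
      (cong₂ _+_ (fv-deg G dx)
        (cong₂ _+_ (fv-deg G da) (cong₂ (λ y z → y + (z + 0)) (fv-deg G db) (fv-deg G dc))))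
      (Σv-restrict-≥ inVf (fv G) xs !xs xs⊆Vf)
    where
    xs = x ∷ a ∷ b ∷ c ∷ []
    !xs : Unique xs
    !xs = (≢-by-deg G dx da (λ ()) ∷ ≢-by-deg G dx db (λ ()) ∷ ≢-by-deg G dx dc (λ ()) ∷ [])
          ∷ unique₃ (Adj⇒≢ G ab) (Adj⇒≢ G ac) (Adj⇒≢ G bc)
    xs⊆Vf : All (λ w → inVf w ≡ true) xs
    xs⊆Vf = ix ∷ ia ∷ ib ∷ ic ∷ []

  branch-rest : ∀ {u r x} → inVf x ≡ true → x ≢ u → x ≢ r → restᵇ (branch u r) x ≡ true
  branch-rest {u} {r} {x} ix x≢u x≢r =
    trans (rest≡∖members (branch u r) x) (∖-intro {p = inVf} (u ∷ r ∷ []) ix (x≢u ∷ x≢r ∷ []))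

  branch-leaf-∉rest : ∀ {u r} → restᵇ (branch u r) u ≡ false
  branch-leaf-∉rest {u} rewrite dec-true (u ≟ u) refl = ∧-zeroʳ (inVf u)

  support-size≡ : (c : Fin n → ℕ) →
    length (filter (λ w → (0 <ᵇ c w) Bool.≟ true) (allFin n)) ≡ Σv (restrict (λ w → 0 <ᵇ c w) one)
  support-size≡ c = length-filter (λ w → 0 <ᵇ c w) (allFin n)

  support-size≥ : ∀ (c : Fin n → ℕ) xs → Unique xs → All (λ x → 1 ≤ c x) xs →
    length xs ≤ length (filter (λ w → (0 <ᵇ c w) Bool.≟ true) (allFin n))
  support-size≥ c xs !xs pos = subst₂ _≤_ (sum-map-const-1 xs) (sym (support-size≡ c))
    (Σv-restrict-≥ (λ w → 0 <ᵇ c w) one xs !xs (All.map <⇒<ᵇ-true pos))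

  neighbour-sum≡ : ∀ r (c : Fin n → ℕ) →
    sum (map c (filter (λ w → adj G r w Bool.≟ true) (allFin n))) ≡ Σv (restrict (adj G r) c)
  neighbour-sum≡ r c = sum-filter (adj G r) c (allFin n)

  branch-bounds : ∀ {u r} → Ind (branch u r) → Sat (branch u r) → 6 ≤ valencyTotal × 4 ≤ vertexTotal
  branch-bounds {u} {r} i@(_ , _ , du , dr , _) (c , support , c≤fv , Σc≡3 , two , _) =
    to (threshold (branch u r) i refl (cong₂ (λ a b → a + (b + 0)) (fv-deg G du) (fv-deg G dr)))
       (subst (_≤ Σv (restrict (restᵇ (branch u r)) (fv G))) Σc≡3 (Σv-mono c≤rest)) ,
    to (threshold (branch u r) i refl refl)
       (≤-trans (subst (2 ≤_) (support-size≡ c) two) (Σv-mono support≤rest))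
    where
    c≤rest : ∀ w → c w ≤ restrict (restᵇ (branch u r)) (fv G) w
    c≤rest w with restᵇ (branch u r) w in e
    ... | true  = c≤fv w
    ... | false = ≤-reflexive (support w e)
    support≤rest : ∀ w → restrict (λ w → 0 <ᵇ c w) one w ≤ restrict (restᵇ (branch u r)) one w
    support≤rest w with restᵇ (branch u r) w in e
    ... | false rewrite support w e = z≤n
    ... | true with 0 <ᵇ c w
    ...   | true  = ≤-refl
    ...   | false = z≤n

  branch-two : ∀ {u r x y} → x ≢ y → restᵇ (branch u r) x ≡ true → restᵇ (branch u r) y ≡ true →
               2 ≤ fv G x → ¬ Adj G r x → Sat (branch u r)
  branch-two {u} {r} {x} {y} x≢y rx ry 2≤fvx r≁x = c , support , c≤fv , Σc≡3 , two-vertices , neighbours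
    where
    c : Fin n → ℕ
    c w = point x 2 w + point y 1 w
    support : ∀ w → restᵇ (branch u r) w ≡ false → c w ≡ 0
    support w e with w ≟ x | w ≟ y
    ... | yes refl | _        = contradiction (trans (sym rx) e) λ ()
    ... | no _     | yes refl = contradiction (trans (sym ry) e) λ ()
    ... | no _     | no _     = refl
    c≤fv : ∀ w → c w ≤ fv G w
    c≤fv w with w ≟ x | w ≟ y
    ... | yes refl | yes refl = contradiction refl x≢y
    ... | yes refl | no _     = subst (_≤ fv G w) (sym (+-identityʳ 2)) 2≤fvx
    ... | no _     | yes refl = inVf⇒1≤fv (restᵇ⇒inVf (branch u r) ry)
    ... | no _     | no _     = z≤n
    Σc≡3 : Σv c ≡ 3
    Σc≡3 = trans (Σv-+ (point x 2) (point y 1)) (cong₂ _+_ (Σv-point x 2) (Σv-point y 1))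
    two-vertices : 2 ≤ length (filter (λ w → (0 <ᵇ c w) Bool.≟ true) (allFin n))
    two-vertices = support-size≥ c (x ∷ y ∷ []) (unique₂ x≢y) (cx-positive ∷ cy-positive ∷ [])
      where
      cx-positive : 1 ≤ c x
      cx-positive rewrite point-self x 2 = s≤s z≤n
      cy-positive : 1 ≤ c y
      cy-positive rewrite point-self y 1 = m≤n+m 1 (point x 2 y)
    neighbours : sum (map c (filter (λ w → adj G r w Bool.≟ true) (allFin n))) ≤ 1
    neighbours = subst (_≤ 1) (sym (neighbour-sum≡ r c))
      (subst (Σv (restrict (adj G r) c) ≤_) (Σv-point y 1) (Σv-mono only-y))
      where
      only-y : ∀ w → restrict (adj G r) c w ≤ point y 1 w
      only-y w with w ≟ x
      ... | yes refl rewrite ¬-not r≁x = z≤n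
      ... | no _ with adj G r w
      ...   | true  = ≤-refl
      ...   | false = z≤n

  neighbour-budget : ∀ {u r} → Ind (branch u r) → (c : Fin n → ℕ) → c u ≡ 0 → (∀ w → c w ≤ 1) →
                     Σv (restrict (adj G r) c) ≤ 1
  neighbour-budget {u} {r} (_ , _ , _ , dr , ur) c cu≡0 c≤1 =
    ≤-trans (Σv-mono pointwise) (≤-reflexive others≡1)
    where
    r~u : adj G r u ≡ true
    r~u = Adj-sym G ur
    others≡1 : Σv (restrict (adj G r ∖₁ u) one) ≡ 1
    others≡1 = +-cancelʳ-≡ 1 _ 1
      (trans (sym (trans (deg≡Σv G r) (Σv-restrict-∖₁ (adj G r) one u r~u))) dr)
    pointwise : ∀ w → restrict (adj G r) c w ≤ restrict (adj G r ∖₁ u) one w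
    pointwise w with w ≟ u
    ... | yes refl rewrite r~u | cu≡0 = z≤n
    ... | no _ with adj G r w
    ...   | true  = c≤1 w
    ...   | false = z≤n

  branch-three : ∀ {u r x y z} → Ind (branch u r) → x ≢ y → x ≢ z → y ≢ z →
                 restᵇ (branch u r) x ≡ true → restᵇ (branch u r) y ≡ true →
                 restᵇ (branch u r) z ≡ true → Sat (branch u r)
  branch-three {u} {r} {x} {y} {z} i x≢y x≢z y≢z rx ry rz =
    c , support , c≤fv , Σc≡3 , two-vertices , neighbours
    where
    c : Fin n → ℕ
    c w = point x 1 w + (point y 1 w + point z 1 w)
    support : ∀ w → restᵇ (branch u r) w ≡ false → c w ≡ 0
    support w e with w ≟ x | w ≟ y | w ≟ z
    ... | yes refl | _        | _        = contradiction (trans (sym rx) e) λ ()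
    ... | no _     | yes refl | _        = contradiction (trans (sym ry) e) λ ()
    ... | no _     | no _     | yes refl = contradiction (trans (sym rz) e) λ ()
    ... | no _     | no _     | no _     = refl
    c≤1 : ∀ w → c w ≤ 1
    c≤1 w with w ≟ x | w ≟ y | w ≟ z
    ... | yes refl | yes refl | _        = contradiction refl x≢y
    ... | yes refl | no _     | yes refl = contradiction refl x≢z
    ... | yes refl | no _     | no _     = ≤-refl
    ... | no _     | yes refl | yes refl = contradiction refl y≢z
    ... | no _     | yes refl | no _     = ≤-refl
    ... | no _     | no _     | yes refl = ≤-refl
    ... | no _     | no _     | no _     = z≤n
    c≤fv : ∀ w → c w ≤ fv G w
    c≤fv w with restᵇ (branch u r) w in e
    ... | true  = ≤-trans (c≤1 w) (inVf⇒1≤fv (restᵇ⇒inVf (branch u r) e))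
    ... | false = subst (_≤ fv G w) (sym (support w e)) z≤n
    Σc≡3 : Σv c ≡ 3
    Σc≡3 = trans (Σv-+ (point x 1) (λ w → point y 1 w + point z 1 w))
             (cong₂ _+_ (Σv-point x 1)
               (trans (Σv-+ (point y 1) (point z 1)) (cong₂ _+_ (Σv-point y 1) (Σv-point z 1))))
    two-vertices : 2 ≤ length (filter (λ w → (0 <ᵇ c w) Bool.≟ true) (allFin n))
    two-vertices = support-size≥ c (x ∷ y ∷ []) (unique₂ x≢y) (cx-positive ∷ cy-positive ∷ [])
      where
      cx-positive : 1 ≤ c x
      cx-positive rewrite point-self x 1 = s≤s z≤n
      cy-positive : 1 ≤ c y
      cy-positive rewrite point-self y 1 = ≤-trans (s≤s z≤n) (m≤n+m (1 + point z 1 y) (point x 1 y))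
    neighbours : sum (map c (filter (λ w → adj G r w Bool.≟ true) (allFin n))) ≤ 1
    neighbours = subst (_≤ 1) (sym (neighbour-sum≡ r c))
      (neighbour-budget i c (support u branch-leaf-∉rest) c≤1)

  -- Exchanging u and u₀ works because both are neighbours of r, the choice vanishes at u₀ and
  -- puts at most one valency on u.  Splitting on u ≟ w rather than w ≟ u keeps 'with' from
  -- abstracting inside the definition of transpose.
  branch-transpose : ∀ {u₀ u r} → Ind (branch u₀ r) → Sat (branch u₀ r) →
                     Ind (branch u r) → Sat (branch u r)
  branch-transpose {u₀} {u} {r} (iu₀ , _ , du₀ , dr , u₀r)
                   (c₀ , support₀ , c₀≤fv , Σc₀≡3 , two₀ , neighbours₀) (_ , _ , _ , _ , ur) =
    c , support , c≤fv , Σc≡3 , two-vertices , neighbours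
    where
    τ : Fin n → Fin n
    τ = transpose u₀ u
    c : Fin n → ℕ
    c = c₀ ∘ τ
    c₀u₀≡0 : c₀ u₀ ≡ 0
    c₀u₀≡0 = support₀ u₀ branch-leaf-∉rest
    neighbour-sum≤1 : Σv (restrict (adj G r) c₀) ≤ 1
    neighbour-sum≤1 = subst (_≤ 1) (neighbour-sum≡ r c₀) neighbours₀
    c₀u≤1 : c₀ u ≤ 1
    c₀u≤1 = ≤-trans (subst (_≤ Σv (restrict (adj G r) c₀)) (+-identityʳ (c₀ u))
                      (Σv-restrict-≥ (adj G r) c₀ (u ∷ []) ([] ∷ []) (Adj-sym G ur ∷ [])))
                    neighbour-sum≤1
    support : ∀ w → restᵇ (branch u r) w ≡ false → c w ≡ 0
    support w e with u ≟ w | u₀ ≟ w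
    ... | yes refl | _        = trans (cong c₀ (transpose-right u₀ u)) c₀u₀≡0
    ... | no u≢w   | yes refl =
      contradiction (trans (sym (branch-rest iu₀ (u≢w ∘ sym) (≢-by-deg G du₀ dr λ ()))) e) λ ()
    ... | no u≢w   | no u₀≢w
      rewrite transpose-other (u₀≢w ∘ sym) (u≢w ∘ sym) | dec-false (w ≟ u) (u≢w ∘ sym) =
      support₀ w (trans (cong (λ b → inVf w ∧ not (b ∨ does (w ≟ r)))
                              (dec-false (w ≟ u₀) (u₀≢w ∘ sym))) e)
    c≤fv : ∀ w → c w ≤ fv G w
    c≤fv w with u ≟ w | u₀ ≟ w
    ... | yes refl | _        rewrite transpose-right u₀ u | c₀u₀≡0 = z≤n
    ... | no _     | yes refl rewrite transpose-left u₀ u = ≤-trans c₀u≤1 (inVf⇒1≤fv iu₀)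
    ... | no u≢w   | no u₀≢w  rewrite transpose-other (u₀≢w ∘ sym) (u≢w ∘ sym) = c₀≤fv w
    Σc≡3 : Σv c ≡ 3
    Σc≡3 = trans (Σv-transpose c₀ u₀ u) Σc₀≡3
    two-vertices : 2 ≤ length (filter (λ w → (0 <ᵇ c w) Bool.≟ true) (allFin n))
    two-vertices = subst (2 ≤_) (sym (begin
      length (filter (λ w → (0 <ᵇ c w) Bool.≟ true) (allFin n))   ≡⟨ support-size≡ c ⟩
      Σv (positive₀ ∘ τ)                                          ≡⟨ Σv-transpose positive₀ u₀ u ⟩
      Σv positive₀                                                ≡⟨ sym (support-size≡ c₀) ⟩
      length (filter (λ w → (0 <ᵇ c₀ w) Bool.≟ true) (allFin n))  ∎)) two₀
      where
      open ≡-Reasoning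
      positive₀ : Fin n → ℕ
      positive₀ = restrict (λ w → 0 <ᵇ c₀ w) one
    neighbours : sum (map c (filter (λ w → adj G r w Bool.≟ true) (allFin n))) ≤ 1
    neighbours = subst (_≤ 1) (sym (begin
      sum (map c (filter (λ w → adj G r w Bool.≟ true) (allFin n)))  ≡⟨ neighbour-sum≡ r c ⟩
      Σv (restrict (adj G r) c)                                      ≡⟨ Σv-cong adj-transpose ⟩
      Σv (restrict (adj G r) c₀ ∘ τ)                                 ≡⟨ Σv-transpose _ u₀ u ⟩
      Σv (restrict (adj G r) c₀)                                     ∎)) neighbour-sum≤1
      where
      open ≡-Reasoning
      adj-transpose : ∀ w → restrict (adj G r) c w ≡ restrict (adj G r) c₀ (τ w)
      adj-transpose w = cong (λ b → if b then c w else 0)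
        (sym (transpose-invariant (adj G r) (trans (Adj-sym G u₀r) (sym (Adj-sym G ur))) w))

  fourth-vertex : ∀ {v u r} → Ind (island v) → Sat (island v) → Ind (branch u r) →
                  ∃ λ w → inVf w ≡ true × All (w ≢_) (v ∷ u ∷ r ∷ [])
  fourth-vertex {v} {u} {r} i@(iv , dv) s (iu , ir , du , dr , ur) =
    let w , w∈others = Σv-restrict-positive (inVf ∖ xs) one others
    in  w , ∖-elim {p = inVf} xs w∈others
    where
    xs = v ∷ u ∷ r ∷ []
    !xs : Unique xs
    !xs = unique₃ (≢-by-deg G dv du λ ()) (≢-by-deg G dv dr λ ()) (Adj⇒≢ G ur)
    others : 1 ≤ Σv (restrict (inVf ∖ xs) one)
    others = +-cancelʳ-≤ 3 1 _
      (subst (4 ≤_) (Σv-restrict-∖ inVf one xs !xs (iv ∷ iu ∷ ir ∷ [])) (to (island⇔ i) s))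

  island⇒branch-satisfied : ∀ {v u r} → Ind (island v) → Sat (island v) → Ind (branch u r) → Sat (branch u r)
  island⇒branch-satisfied i@(iv , dv) s j@(_ , _ , du , dr , _) with fourth-vertex i s j
  ... | w , iw , w≢v ∷ w≢u ∷ w≢r ∷ [] =
    branch-two (w≢v ∘ sym) (branch-rest iv (≢-by-deg G dv du λ ()) (≢-by-deg G dv dr λ ()))
      (branch-rest iw w≢u w≢r) (2≤fv G dv (s≤s (s≤s z≤n))) (deg0-isolated G dv ∘ Adj-sym G)

  stick⇒branch-satisfied : ∀ {x y u r} → Ind (stick x y) → Ind (branch u r) → Sat (branch u r)
  stick⇒branch-satisfied {x} {y} {u} {r} (ix , iy , dx , dy , xy) (_ , _ , du , dr , ur) =
    branch-two (Adj⇒≢ G xy) (branch-rest ix x≢u x≢r) (branch-rest iy y≢u y≢r)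
      (2≤fv G dx (s≤s (s≤s z≤n))) (λ rx → y≢r (deg1-neighbour-unique G dx xy (Adj-sym G rx)))
    where
    x≢r = ≢-by-deg G dx dr λ ()
    y≢r = ≢-by-deg G dy dr λ ()
    x≢u : x ≢ u
    x≢u refl = y≢r (deg1-neighbour-unique G dx xy ur)
    y≢u : y ≢ u
    y≢u refl = x≢r (deg1-neighbour-unique G dy (Adj-sym G xy) ur)

  islands2⇒branch-satisfied : ∀ {x y u r} → Ind (islands2 x y) → Ind (branch u r) → Sat (branch u r)
  islands2⇒branch-satisfied (ix , iy , dx , dy , x≢y) (_ , _ , du , dr , _) =
    branch-two x≢y (branch-rest ix (≢-by-deg G dx du λ ()) (≢-by-deg G dx dr λ ()))
      (branch-rest iy (≢-by-deg G dy du λ ()) (≢-by-deg G dy dr λ ()))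
      (2≤fv G dx (s≤s (s≤s z≤n))) (deg0-isolated G dx ∘ Adj-sym G)

  cycle3⇒branch-satisfied : ∀ {a b c u r} → Ind (cycle3 a b c) → Ind (branch u r) → Sat (branch u r)
  cycle3⇒branch-satisfied {a} {b} {c} {u} {r}
    (ia , ib , ic , da , db , dc , ab , bc , ac) j@(_ , _ , du , dr , ur) =
    branch-three j a≢b a≢c b≢c
      (branch-rest ia (u≢a ∘ sym) a≢r) (branch-rest ib (u≢b ∘ sym) b≢r) (branch-rest ic (u≢c ∘ sym) c≢r)
    where
    a≢b = Adj⇒≢ G ab
    a≢c = Adj⇒≢ G ac
    b≢c = Adj⇒≢ G bc
    u≢a = ≢-by-deg G du da λ ()
    u≢b = ≢-by-deg G du db λ ()
    u≢c = ≢-by-deg G du dc λ ()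
    a≢r : a ≢ r
    a≢r refl = deg2-three-neighbours G da (unique₃ u≢b u≢c b≢c) (Adj-sym G ur ∷ ab ∷ ac ∷ [])
    b≢r : b ≢ r
    b≢r refl = deg2-three-neighbours G db (unique₃ u≢a u≢c a≢c) (Adj-sym G ur ∷ Adj-sym G ab ∷ bc ∷ [])
    c≢r : c ≢ r
    c≢r refl = deg2-three-neighbours G dc (unique₃ u≢a u≢b a≢b)
                 (Adj-sym G ur ∷ Adj-sym G ac ∷ Adj-sym G bc ∷ [])

  branch⇒branch-satisfied : ∀ {u₀ r₀ u r} → Ind (branch u₀ r₀) → Sat (branch u₀ r₀) →
                            Ind (branch u r) → Sat (branch u r)
  branch⇒branch-satisfied {r₀ = r₀} {r = r} i s j with r ≟ r₀
  ... | yes refl = branch-transpose i s j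
  branch⇒branch-satisfied {u₀} {r₀} {u} {r} (iu₀ , ir₀ , du₀ , dr₀ , u₀r₀) _ (_ , _ , du , dr , ur)
    | no r≢r₀ =
    branch-two (Adj⇒≢ G u₀r₀) (branch-rest iu₀ u₀≢u (≢-by-deg G du₀ dr λ ()))
      (branch-rest ir₀ (≢-by-deg G dr₀ du λ ()) (r≢r₀ ∘ sym))
      (2≤fv G du₀ (s≤s (s≤s z≤n)))
      (λ ru₀ → r≢r₀ (deg1-neighbour-unique G du₀ (Adj-sym G ru₀) u₀r₀))
    where
    u₀≢u : u₀ ≢ u
    u₀≢u refl = r≢r₀ (deg1-neighbour-unique G du ur u₀r₀)

  joker-satisfied : ∀ S → Ind S → Sat S → ∀ {v} → Ind (joker v) → Sat (joker v)
  joker-satisfied S i s j = from (joker⇔ j) (bound S i s)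
    where
    bound : ∀ S → Ind S → Sat S → 2 ≤ valencyTotal
    bound (joker _)      i s = to (joker⇔ i) s
    bound (pair _ _)     i s = ≤-trans (m≤m+n 2 2) (to (pair⇔ i) s)
    bound (leaf _)       i s = ≤-trans (m≤m+n 2 1) (≤-trans (to (leaf⇔ i) s) vertex≤valency)
    bound (branch _ _)   i s = ≤-trans (m≤m+n 2 4) (proj₁ (branch-bounds i s))
    bound (island _)     i s = ≤-trans (m≤m+n 2 2) (≤-trans (to (island⇔ i) s) vertex≤valency)
    bound (stick _ _)    i s = ≤-trans (m≤m+n 2 6) (≤-trans (to (stick⇔ i) s) capped≤valency)
    bound (islands2 _ _) i s = ≤-trans (m≤m+n 2 6) (≤-trans (to (islands2⇔ i) s) capped≤valency)
    bound (cycle3 _ _ _) i s = ≤-trans (m≤m+n 2 4) (to (cycle3⇔ i) s)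

  pair-satisfied : ∀ S → Ind S → Sat S → 2 ≤ demand S → ∀ {u v} → Ind (pair u v) → Sat (pair u v)
  pair-satisfied S i s d j = from (pair⇔ j) (bound S i s d)
    where
    bound : ∀ S → Ind S → Sat S → 2 ≤ demand S → 4 ≤ valencyTotal
    bound (joker _)      i s (s≤s ())
    bound (pair _ _)     i s _ = to (pair⇔ i) s
    bound (leaf _)       i s _ = proj₂ (leaf-pair-bounds i j)
    bound (branch _ _)   i s _ = ≤-trans (m≤m+n 4 2) (proj₁ (branch-bounds i s))
    bound (island _)     i s _ = ≤-trans (to (island⇔ i) s) vertex≤valency
    bound (stick _ _)    i s _ = ≤-trans (m≤m+n 4 4) (≤-trans (to (stick⇔ i) s) capped≤valency)
    bound (islands2 _ _) i s _ = ≤-trans (m≤m+n 4 4) (≤-trans (to (islands2⇔ i) s) capped≤valency)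
    bound (cycle3 _ _ _) i s _ = ≤-trans (m≤m+n 4 2) (to (cycle3⇔ i) s)

  leaf-satisfied : ∀ S → Ind S → Sat S → 2 ≤ demand S → ∀ {v} → Ind (leaf v) → Sat (leaf v)
  leaf-satisfied S i s d j = from (leaf⇔ j) (bound S i s d)
    where
    bound : ∀ S → Ind S → Sat S → 2 ≤ demand S → 3 ≤ vertexTotal
    bound (joker _)      i s (s≤s ())
    bound (pair _ _)     i s _ = proj₁ (leaf-pair-bounds j i)
    bound (leaf _)       i s _ = to (leaf⇔ i) s
    bound (branch _ _)   i s _ = ≤-trans (m≤m+n 3 1) (proj₂ (branch-bounds i s))
    bound (island _)     i s _ = ≤-trans (m≤m+n 3 1) (to (island⇔ i) s)
    bound (stick _ _)    i s _ = ≤-trans (m≤m+n 3 1) (8≤capped⇒4≤vertex (to (stick⇔ i) s))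
    bound (islands2 _ _) i s _ = ≤-trans (m≤m+n 3 1) (8≤capped⇒4≤vertex (to (islands2⇔ i) s))
    bound (cycle3 _ _ _) i s _ = members≤total (cycle3 _ _ _) one i

  island-satisfied : ∀ S → Ind S → Sat S → 3 ≤ demand S → ∀ {v} → Ind (island v) → Sat (island v)
  island-satisfied S i s d j = from (island⇔ j) (bound S i s d)
    where
    bound : ∀ S → Ind S → Sat S → 3 ≤ demand S → 4 ≤ vertexTotal
    bound (joker _)      i s (s≤s ())
    bound (pair _ _)     i s (s≤s (s≤s ()))
    bound (leaf _)       i s (s≤s (s≤s ()))
    bound (branch _ _)   i s _ = proj₂ (branch-bounds i s)
    bound (island _)     i s _ = to (island⇔ i) s
    bound (stick _ _)    i s _ = 8≤capped⇒4≤vertex (to (stick⇔ i) s)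
    bound (islands2 _ _) i s _ = 8≤capped⇒4≤vertex (to (islands2⇔ i) s)
    bound (cycle3 _ _ _) i s _ = proj₁ (island-cycle3-bounds j i)

  cycle3-satisfied : ∀ S → Ind S → Sat S → 3 ≤ demand S →
                     ∀ {a b c} → Ind (cycle3 a b c) → Sat (cycle3 a b c)
  cycle3-satisfied S i s d j = from (cycle3⇔ j) (bound S i s d)
    where
    bound : ∀ S → Ind S → Sat S → 3 ≤ demand S → 6 ≤ valencyTotal
    bound (joker _)      i s (s≤s ())
    bound (pair _ _)     i s (s≤s (s≤s ()))
    bound (leaf _)       i s (s≤s (s≤s ()))
    bound (branch _ _)   i s _ = proj₁ (branch-bounds i s)
    bound (island _)     i s _ = proj₂ (island-cycle3-bounds i j)
    bound (stick _ _)    i s _ = ≤-trans (m≤m+n 6 2) (≤-trans (to (stick⇔ i) s) capped≤valency)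
    bound (islands2 _ _) i s _ = ≤-trans (m≤m+n 6 2) (≤-trans (to (islands2⇔ i) s) capped≤valency)
    bound (cycle3 _ _ _) i s _ = to (cycle3⇔ i) s

  branch-satisfied : ∀ S → Ind S → Sat S → 3 ≤ demand S → ∀ {u r} → Ind (branch u r) → Sat (branch u r)
  branch-satisfied (joker _)      i s (s≤s ())
  branch-satisfied (pair _ _)     i s (s≤s (s≤s ()))
  branch-satisfied (leaf _)       i s (s≤s (s≤s ()))
  branch-satisfied (branch _ _)   i s _ = branch⇒branch-satisfied i s
  branch-satisfied (island _)     i s _ = island⇒branch-satisfied i s
  branch-satisfied (stick _ _)    i _ _ = stick⇒branch-satisfied i
  branch-satisfied (islands2 _ _) i _ _ = islands2⇒branch-satisfied i
  branch-satisfied (cycle3 _ _ _) i _ _ = cycle3⇒branch-satisfied i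

  4≤demand⇒8≤capped : ∀ S → Ind S → Sat S → 4 ≤ demand S → 8 ≤ cappedTotal
  4≤demand⇒8≤capped (joker _)      i s (s≤s ())
  4≤demand⇒8≤capped (pair _ _)     i s (s≤s (s≤s ()))
  4≤demand⇒8≤capped (leaf _)       i s (s≤s (s≤s ()))
  4≤demand⇒8≤capped (branch _ _)   i s (s≤s (s≤s (s≤s ())))
  4≤demand⇒8≤capped (island _)     i s (s≤s (s≤s (s≤s ())))
  4≤demand⇒8≤capped (stick _ _)    i s _ = to (stick⇔ i) s
  4≤demand⇒8≤capped (islands2 _ _) i s _ = to (islands2⇔ i) s
  4≤demand⇒8≤capped (cycle3 _ _ _) i s (s≤s (s≤s (s≤s ())))

  satisfied-downward : ∀ S → Ind S → Sat S → ∀ S′ → Ind S′ → demand S′ ≤ demand S → Sat S′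
  satisfied-downward S i s (joker _)      j d = joker-satisfied S i s j
  satisfied-downward S i s (pair _ _)     j d = pair-satisfied S i s d j
  satisfied-downward S i s (leaf _)       j d = leaf-satisfied S i s d j
  satisfied-downward S i s (branch _ _)   j d = branch-satisfied S i s d j
  satisfied-downward S i s (island _)     j d = island-satisfied S i s d j
  satisfied-downward S i s (stick _ _)    j d = from (stick⇔ j) (4≤demand⇒8≤capped S i s d)
  satisfied-downward S i s (islands2 _ _) j d = from (islands2⇔ j) (4≤demand⇒8≤capped S i s d)
  satisfied-downward S i s (cycle3 _ _ _) j d = cycle3-satisfied S i s d j

lemma2 : ∀ {n m} (G : Graph n) (Inc : Fin n → Fin m → Set) (A : Fin n → Fin m) →
    IsNodeAssignment G Inc A → (f : Fin m) (S : Cand n) →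
    IsMaxIndicator G A f S →
    (MatchingCondition G A f ⇔ Satisfied G A f S)
lemma2 G Inc A _ f S (indS , maximal) =
  mk⇔ (λ matching → matching S indS)
      (λ satS S′ indS′ → Face.satisfied-downward G A f S indS satS S′ indS′ (maximal S′ indS′))
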